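{- Let $n>1$ and $m>1$ be integers and let $G$ be an $r$-regular bipartite graph of order $m$ whose two partite sets each have $m/2$ vertices. Then $\chi_{ld}(G[\overline{K_n}])=2$.
   Context: For a graph $G=(V,E)$ of order $N$ and a bijection $f\colon V\to\{1,\dots,N\}$, the weight of a vertex $u$ is $w(u)=\sum_{x\in N(u)}f(x)$, where $N(u)$ is the open neighborhood of $u$. The bijection $f$ is a local distance antimagic labeling if $w(u)\neq w(v)$ for every edge $uv$. $\chi_{ld}(G)$ is the minimum number of distinct weights over all local distance antimagic labelings of $G$. $\overline{K_n}$ is the edgeless graph on $n$ vertices. The lexicographic product $G[H]$ has vertex set $V(G)\times V(H)$, with $(g,h)$ adjacent to $(g',h')$ iff $gg'\in E(G)$, or $g=g'$ and $hh'\in E(H)$. -}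

module Defs where

open import Data.Nat using (ℕ; zero; suc; _+_; _*_; _≤_; _≟_)
open import Data.Bool using (Bool; true; false; if_then_else_; not; _∨_; _∧_)
open import Data.Fin.Properties using () renaming (_≟_ to _≟F_)
open import Relation.Nullary.Decidable using (⌊_⌋; yes; no)
open import Data.Empty using (⊥-elim)
open import Data.Fin using (Fin; toℕ; remQuot)
open import Data.Fin.Permutation using (Permutation′; _⟨$⟩ʳ_)
open import Data.Nat.ListAction using (sum)
open import Data.List using (List; map; length; deduplicate; filter)
open import Data.List using (allFin) public
open import Data.Product using (Σ; _×_; _,_; proj₁; proj₂; ∃)
open import Relation.Binary.PropositionalEquality using (_≡_; _≢_; refl; cong)
open import Relation.Nullary using (¬_)

record Graph (N : ℕ) : Set where
  field
    adj   : Fin N → Fin N → Bool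
    sym   : ∀ u v → adj u v ≡ adj v u
    irrefl : ∀ u → adj u u ≡ false
open Graph public

countT : ∀ {N} → (Fin N → Bool) → ℕ
countT {N} p = length (filter (λ i → p i Data.Bool.≟ true) (allFin N))

degree : ∀ {N} → Graph N → Fin N → ℕ
degree G u = countT (adj G u)

Regular : ∀ {N} → ℕ → Graph N → Set
Regular r G = ∀ u → degree G u ≡ r

BalancedBipartite : ∀ {m} → Graph m → Set
BalancedBipartite {m} G =
  Σ (Fin m → Bool) λ side →
    (∀ u v → adj G u v ≡ true → side u ≢ side v) ×
    (countT side ≡ countT (λ i → not (side i)))

emptyGraph : (n : ℕ) → Graph n
emptyGraph n = record { adj = λ _ _ → false ; sym = λ _ _ → _≡_.refl ; irrefl = λ _ → _≡_.refl }

-- lexicographic product G[H]; vertex (g , h) is encoded as combine g h : Fin (m * n)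
-- (decoded by remQuot).  (g,h) ~ (g',h') iff g g' adjacent in G, or g = g' and h h' adjacent in H.
lexAdj' : ∀ {m n} → Graph m → Graph n → Fin m × Fin n → Fin m × Fin n → Bool
lexAdj' G H (g , h) (g' , h') = adj G g g' ∨ (⌊ g ≟F g' ⌋ ∧ adj H h h')

lexAdj'-sym : ∀ {m n} (G : Graph m) (H : Graph n) p q → lexAdj' G H p q ≡ lexAdj' G H q p
lexAdj'-sym G H (g , h) (g' , h') with g ≟F g' | g' ≟F g
... | yes refl | yes _ = cong (adj G g g ∨_) (sym H h h')
... | yes refl | no ¬p = ⊥-elim (¬p refl)
... | no ¬p | yes refl = ⊥-elim (¬p refl)
... | no _ | no _ = cong (_∨ false) (sym G g g')

lexAdj'-irrefl : ∀ {m n} (G : Graph m) (H : Graph n) p → lexAdj' G H p p ≡ false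
lexAdj'-irrefl G H (g , h) with g ≟F g
... | yes _ rewrite irrefl G g | irrefl H h = refl
... | no ¬p = ⊥-elim (¬p refl)

lexProduct : ∀ {m n} → Graph m → Graph n → Graph (m * n)
lexProduct {m} {n} G H = record
  { adj    = λ x y → lexAdj' G H (remQuot {m} n x) (remQuot {m} n y)
  ; sym    = λ x y → lexAdj'-sym G H (remQuot {m} n x) (remQuot {m} n y)
  ; irrefl = λ x → lexAdj'-irrefl G H (remQuot {m} n x)
  }

-- A labeling is a bijection f : V → {1,…,N}, given as a permutation π of Fin N
-- with f x = 1 + π x.
label : ∀ {N} → Permutation′ N → Fin N → ℕ
label π x = suc (toℕ (π ⟨$⟩ʳ x))

weight : ∀ {N} → Graph N → Permutation′ N → Fin N → ℕ
weight {N} G π u = sum (map (λ x → if adj G u x then label π x else 0) (allFin N))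

IsLocalDistanceAntimagic : ∀ {N} → Graph N → Permutation′ N → Set
IsLocalDistanceAntimagic G π = ∀ u v → adj G u v ≡ true → weight G π u ≢ weight G π v

numWeights : ∀ {N} → Graph N → Permutation′ N → ℕ
numWeights {N} G π = length (deduplicate _≟_ (map (weight G π) (allFin N)))

ChiLd≡ : ∀ {N} → Graph N → ℕ → Set
ChiLd≡ {N} G k =
  (Σ (Permutation′ N) λ π → IsLocalDistanceAntimagic G π × numWeights G π ≡ k) ×
  (∀ π → IsLocalDistanceAntimagic G π → k ≤ numWeights G π)

-- Label the vertex (g, h) of G[K̄ₙ] by n · a(g, h) + h + 1, where every column a(·, h) of an
-- m × n array a is a bijection onto {0, …, m − 1}.  This is a bijection onto {1, …, mn}, and the
-- label sum over the copy {g} × K̄ₙ of g is n · Σₕ a(g, h) plus a constant.  Writing m = 2k and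
-- indexing each partite set by {0, …, k − 1}, the array can be chosen so that its row sums are
-- constant on each partite set and different on the two: a pair of columns x, m − 1 − x adds
-- m − 1 to every row, and the remaining two or three columns (by the parity of n) separate the
-- sides.  Then in an r-regular bipartite G every vertex of G[K̄ₙ] has weight r times the row sum
-- of the opposite side, so adjacent vertices get different weights and only two weights occur;
-- and a local distance antimagic labeling of a graph with an edge always has at least two.
module Submission where

open import Defs hiding (sym)

open import Data.Bool using (Bool; true; false; not; if_then_else_; _∨_) renaming (_≟_ to _≟ᵇ_)
open import Data.Bool.Properties using (¬-not; not-injective; ∧-zeroʳ; ∨-identityʳ)
open import Data.Fin
  using (Fin; zero; suc; toℕ; fromℕ<; cast; opposite; combine; remQuot; quotient; _↑ˡ_; _↑ʳ_; punchOut)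
  renaming (_<_ to _<ᶠ_)
open import Data.Fin.Patterns using (0F; 1F)
open import Data.Fin.Properties
  using (2↔Bool; toℕ-injective; toℕ-cast; toℕ-fromℕ<; toℕ-combine; combine-injective;
         remQuot-combine; combine-remQuot; opposite-prop; opposite-involutive; toℕ≤pred[n];
         injective⇒≤; punchOut-injective; any?)
  renaming (_≟_ to _≟ᶠ_; <-cmp to <-cmpᶠ)
open import Data.Fin.Permutation using (Permutation′; permutation)
open import Data.List using (List; []; _∷_; length; map; filter; tabulate; deduplicate)
open import Data.List.Membership.Propositional using (_∈_)
open import Data.List.Membership.Propositional.Properties
  using (∈-map⁺; ∈-map⁻; ∈-allFin; ∈-deduplicate⁺; ∈-deduplicate⁻)
open import Data.List.Relation.Unary.Any using (here; there)
open import Data.List.Relation.Unary.All using (_∷_)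
open import Data.List.Relation.Unary.AllPairs using (_∷_)
open import Data.List.Relation.Unary.Unique.Propositional using (Unique)
open import Data.List.Relation.Unary.Unique.DecPropositional.Properties using (deduplicate-!)
open import Data.Nat using (ℕ; zero; suc; _+_; _*_; _<_; _≤_; z≤n; s≤s; z<s; pred; NonZero; _≟_)
open import Data.Nat.Properties
  using (+-*-semiring; +-identityʳ; +-assoc; +-suc; *-identityʳ; *-comm; +-monoʳ-<; <-≤-trans; ≤-reflexive;
         ≤-antisym; <⇒≢; <-irrefl; m<n⇒0<n; m+[n∸m]≡n; m<n+m; n<1+n; +-cancelʳ-≡; *-cancelˡ-≡)
import Data.Nat.ListAction as ListAction
open import Data.Nat.Tactic.RingSolver using (solve-∀)
open import Algebra.Properties.Semiring.Sum +-*-semiring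
  using (sum-syntax; sum-cong-≗; ∑-distrib-+; *-distribˡ-sum; *-distribʳ-sum)
open import Data.Product
  using (Σ; ∃; _×_; _,_; proj₁; proj₂; uncurry; map₁; map₂; swap) renaming (map to mapΣ)
open import Data.Sum using (_⊎_; inj₁; inj₂)
open import Function using (_∘_; id; Inverse; Injection)
open import Function.Definitions using (Injective)
open import Function.Properties.Inverse using (↔-sym; Inverse⇒Injection)
open import Relation.Binary using (tri<; tri≈; tri>)
open import Relation.Binary.PropositionalEquality
open import Relation.Nullary using (yes; no; contradiction)

indicator : Bool → ℕ
indicator b = if b then 1 else 0

count : ∀ {N} → (Fin N → Bool) → ℕ
count {N} p = ∑[ i < N ] indicator (p i)

if≡indicator* : ∀ b x → (if b then x else 0) ≡ indicator b * x
if≡indicator* true  x = sym (+-identityʳ x)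
if≡indicator* false x = refl

listSum-map-tabulate : ∀ {A : Set} {N} (f : A → ℕ) (g : Fin N → A) →
  ListAction.sum (map f (tabulate g)) ≡ ∑[ i < N ] f (g i)
listSum-map-tabulate {N = zero}  f g = refl
listSum-map-tabulate {N = suc N} f g = cong (f (g zero) +_) (listSum-map-tabulate f (g ∘ suc))

length-filter-tabulate : ∀ {A : Set} {N} (p : A → Bool) (g : Fin N → A) →
  length (filter (λ x → p x ≟ᵇ true) (tabulate g)) ≡ ∑[ i < N ] indicator (p (g i))
length-filter-tabulate {N = zero}  p g = refl
length-filter-tabulate {N = suc N} p g with p (g zero)
... | true  = cong suc (length-filter-tabulate p (g ∘ suc))
... | false = length-filter-tabulate p (g ∘ suc)

countT≡count : ∀ {N} (p : Fin N → Bool) → countT p ≡ count p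
countT≡count p = length-filter-tabulate p id

count-complement : ∀ {N} (p : Fin N → Bool) → count p + count (not ∘ p) ≡ N
count-complement {zero}  p = refl
count-complement {suc N} p with p zero
... | true  = cong suc (count-complement (p ∘ suc))
... | false = trans (+-suc _ _) (cong suc (count-complement (p ∘ suc)))

count>0⇒∃ : ∀ {N} (p : Fin N → Bool) → 0 < count p → ∃ λ i → p i ≡ true
count>0⇒∃ {suc N} p positive with p zero in p0
... | true  = zero , p0
... | false = mapΣ suc id (count>0⇒∃ (p ∘ suc) positive)

∑-splitAt : ∀ a b (f : Fin (a + b) → ℕ) →
  ∑[ i < a + b ] f i ≡ ∑[ i < a ] f (i ↑ˡ b) + ∑[ j < b ] f (a ↑ʳ j)
∑-splitAt zero    b f = refl
∑-splitAt (suc a) b f = trans (cong (f zero +_) (∑-splitAt a b (f ∘ suc))) (sym (+-assoc (f zero) _ _))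

∑-combine : ∀ m n (f : Fin (m * n) → ℕ) →
  ∑[ x < m * n ] f x ≡ ∑[ i < m ] ∑[ j < n ] f (combine i j)
∑-combine zero    n f = refl
∑-combine (suc m) n f =
  trans (∑-splitAt n (m * n) f) (cong (∑[ j < n ] f (j ↑ˡ (m * n)) +_) (∑-combine m n (f ∘ (n ↑ʳ_))))

rank : ∀ {N} → (Fin N → Bool) → Fin N → ℕ
rank p zero    = 0
rank p (suc i) = indicator (p zero) + rank (p ∘ suc) i

rank<count : ∀ {N} (p : Fin N → Bool) {i} → p i ≡ true → rank p i < count p
rank<count p {zero}  pi rewrite pi = s≤s z≤n
rank<count p {suc i} pi = +-monoʳ-< (indicator (p zero)) (rank<count (p ∘ suc) pi)

rank-strictMono : ∀ {N} (p : Fin N → Bool) {i j} → p i ≡ true → i <ᶠ j → rank p i < rank p j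
rank-strictMono p {zero}  {suc j} pi _ rewrite pi = s≤s z≤n
rank-strictMono p {suc i} {suc j} pi (s≤s i<j) =
  +-monoʳ-< (indicator (p zero)) (rank-strictMono (p ∘ suc) pi i<j)

rank-injective : ∀ {N} (p : Fin N → Bool) {i j} → p i ≡ true → p j ≡ true →
  rank p i ≡ rank p j → i ≡ j
rank-injective p {i} {j} pi pj sameRank with <-cmpᶠ i j
... | tri< i<j _ _ = contradiction sameRank (<⇒≢ (rank-strictMono p pi i<j))
... | tri≈ _ i≡j _ = i≡j
... | tri> _ _ j<i = contradiction (sym sameRank) (<⇒≢ (rank-strictMono p pj j<i))

colourClassIndexing : ∀ {N k} (c : Fin N → Bool) → count c ≡ k → count (not ∘ c) ≡ k →
  Σ (Fin N → Fin k) λ ρ → ∀ {g g′} → c g ≡ c g′ → ρ g ≡ ρ g′ → g ≡ g′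
colourClassIndexing {N} {k} c trueCount falseCount = ρ , ρ-injective
  where
  inClass : Bool → Fin N → Bool
  inClass s i = if s then c i else not (c i)

  inOwnClass : ∀ g → inClass (c g) g ≡ true
  inOwnClass g with c g
  ... | true  = refl
  ... | false = refl

  classSize : ∀ s → count (inClass s) ≡ k
  classSize true  = trueCount
  classSize false = falseCount

  ρ : Fin N → Fin k
  ρ g = fromℕ< (<-≤-trans (rank<count (inClass (c g)) (inOwnClass g)) (≤-reflexive (classSize (c g))))

  ρ-injective : ∀ {g g′} → c g ≡ c g′ → ρ g ≡ ρ g′ → g ≡ g′
  ρ-injective {g} {g′} sameClass sameIndex =
    rank-injective (inClass (c g)) (inOwnClass g)
      (subst (λ s → inClass s g′ ≡ true) (sym sameClass) (inOwnClass g′))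
      (begin
        rank (inClass (c g)) g    ≡⟨ toℕ-fromℕ< _ ⟨
        toℕ (ρ g)                 ≡⟨ cong toℕ sameIndex ⟩
        toℕ (ρ g′)                ≡⟨ toℕ-fromℕ< _ ⟩
        rank (inClass (c g′)) g′  ≡⟨ cong (λ s → rank (inClass s) g′) sameClass ⟨
        rank (inClass (c g)) g′   ∎)
    where open ≡-Reasoning

balanced⇒halves : ∀ {m} (c : Fin m → Bool) → count c ≡ count (not ∘ c) → 0 < m →
  ∃ λ k → count c ≡ suc k × count (not ∘ c) ≡ suc k
balanced⇒halves c balanced m>0 with count c in trueCount
... | suc k = k , refl , sym balanced
... | zero  = contradiction (trans (sym (count-complement c)) (cong₂ _+_ trueCount (sym balanced)))
                            (<⇒≢ m>0 ∘ sym)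

injective⇒surjective : ∀ {N} (f : Fin N → Fin N) → Injective _≡_ _≡_ f → ∀ y → ∃ λ x → f x ≡ y
injective⇒surjective {suc N} f f-injective y with any? (λ x → f x ≟ᶠ y)
... | yes hit = hit
... | no miss = contradiction (injective⇒≤ avoid-injective) (<-irrefl refl)
  where
  avoid : Fin (suc N) → Fin N
  avoid x = punchOut {i = y} (λ y≡fx → miss (x , sym y≡fx))

  avoid-injective : Injective _≡_ _≡_ avoid
  avoid-injective eq = f-injective (punchOut-injective {i = y} _ _ eq)

injective⇒permutation : ∀ {N} (f : Fin N → Fin N) → Injective _≡_ _≡_ f → Permutation′ N
injective⇒permutation f f-injective =
  permutation f (proj₁ ∘ preimage) (proj₂ ∘ preimage) (λ x → f-injective (proj₂ (preimage (f x))))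
  where
  preimage : ∀ y → ∃ λ x → f x ≡ y
  preimage = injective⇒surjective f f-injective

opposite-injective : ∀ {n} → Injective _≡_ _≡_ (opposite {n})
opposite-injective {x = i} {j} eq =
  trans (sym (opposite-involutive i)) (trans (cong opposite eq) (opposite-involutive j))

cast-injective : ∀ {m n} .(eq : m ≡ n) {i j : Fin m} → cast eq i ≡ cast eq j → i ≡ j
cast-injective eq {i} {j} same =
  toℕ-injective (trans (sym (toℕ-cast eq i)) (trans (cong toℕ same) (toℕ-cast eq j)))

toℕ+toℕ-opposite : ∀ {n} (i : Fin n) → toℕ i + toℕ (opposite i) ≡ pred n
toℕ+toℕ-opposite {suc n} i = trans (cong (toℕ i +_) (opposite-prop i)) (m+[n∸m]≡n (toℕ≤pred[n] i))

bit : Bool → Fin 2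
bit = Inverse.from 2↔Bool

bit-injective : Injective _≡_ _≡_ bit
bit-injective = Injection.injective (Inverse⇒Injection (↔-sym 2↔Bool))

-- Written with q * 2 so that Fin (suc q * 2) reduces to Fin (2 + q * 2): columns can then be
-- consumed two at a time by pattern matching.
data Parity : ℕ → Set where
  even : ∀ q → Parity (2 + q * 2)
  odd  : ∀ q → Parity (3 + q * 2)

parity+2 : ∀ n → Parity (2 + n)
parity+2 zero          = even 0
parity+2 (suc zero)    = odd 0
parity+2 (suc (suc n)) with parity+2 n
... | even q = even (suc q)
... | odd  q = odd (suc q)

parity : ∀ {n} → 1 < n → Parity n
parity (s≤s (s≤s _)) = parity+2 _

Parity⇒NonZero : ∀ {n} → Parity n → NonZero n
Parity⇒NonZero (even q) = _
Parity⇒NonZero (odd  q) = _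

-- The array is given column by column: the entry in column h and row (b, j), with b the side
-- and j the index within it, is columns P h b j.  The entry combine b j has value k · b + j.
oppositePairColumns : ∀ {k} q → Fin (q * 2) → Fin 2 → Fin k → Fin (2 * k)
oppositePairColumns (suc q) zero          b j = combine b j
oppositePairColumns (suc q) (suc zero)    b j = opposite (combine b j)
oppositePairColumns (suc q) (suc (suc h))     = oppositePairColumns q h

columns : ∀ {k n} → Parity n → Fin n → Fin 2 → Fin k → Fin (2 * k)
columns     (even q) zero                b j = combine b j
columns     (even q) (suc zero)          b j = combine b (opposite j)
columns     (even q) (suc (suc h))           = oppositePairColumns q h
columns     (odd q)  zero                b j = combine b j
columns     (odd q)  (suc zero)          b j = combine (opposite b) j
columns {k} (odd q)  (suc (suc zero))    b j = cast (*-comm k 2) (combine (opposite j) b)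
columns     (odd q)  (suc (suc (suc h)))     = oppositePairColumns q h

oppositePairColumns-injective : ∀ {k} q h {b b′ : Fin 2} {j j′ : Fin k} →
  oppositePairColumns q h b j ≡ oppositePairColumns q h b′ j′ → b ≡ b′ × j ≡ j′
oppositePairColumns-injective (suc q) zero          = combine-injective _ _ _ _
oppositePairColumns-injective (suc q) (suc zero)    = combine-injective _ _ _ _ ∘ opposite-injective
oppositePairColumns-injective (suc q) (suc (suc h)) = oppositePairColumns-injective q h

columns-injective : ∀ {k n} (P : Parity n) h {b b′ : Fin 2} {j j′ : Fin k} →
  columns P h b j ≡ columns P h b′ j′ → b ≡ b′ × j ≡ j′
columns-injective     (even q) zero                = combine-injective _ _ _ _
columns-injective     (even q) (suc zero)          = map₂ opposite-injective ∘ combine-injective _ _ _ _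
columns-injective     (even q) (suc (suc h))       = oppositePairColumns-injective q h
columns-injective     (odd q)  zero                = combine-injective _ _ _ _
columns-injective     (odd q)  (suc zero)          = map₁ opposite-injective ∘ combine-injective _ _ _ _
columns-injective {k} (odd q)  (suc (suc zero))    =
  swap ∘ map₁ opposite-injective ∘ combine-injective _ _ _ _ ∘ cast-injective (*-comm k 2)
columns-injective     (odd q)  (suc (suc (suc h))) = oppositePairColumns-injective q h

∑-oppositePairColumns : ∀ {k} q (b : Fin 2) (j : Fin k) →
  ∑[ h < q * 2 ] toℕ (oppositePairColumns q h b j) ≡ q * pred (2 * k)
∑-oppositePairColumns zero    b j = refl
∑-oppositePairColumns (suc q) b j =
  trans (sym (+-assoc (toℕ (combine b j)) _ _))
        (cong₂ _+_ (toℕ+toℕ-opposite (combine b j)) (∑-oppositePairColumns q b j))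

arrayRowSum : ∀ {n} (k : ℕ) → Parity n → Fin 2 → ℕ
arrayRowSum k (even q) b = toℕ b * (k + k) + (pred k + q * pred (2 * k))
arrayRowSum k (odd q)  b = toℕ b + (k + 2 * pred k) + q * pred (2 * k)

∑-columns : ∀ {k n} (P : Parity n) b (j : Fin k) → ∑[ h < n ] toℕ (columns P h b j) ≡ arrayRowSum k P b
∑-columns {k} (even q) b j = begin
  toℕ (combine b j) + (toℕ (combine b (opposite j)) + ∑[ h < q * 2 ] toℕ (oppositePairColumns q h b j))
    ≡⟨ cong₂ _+_ (toℕ-combine b j)
         (cong₂ _+_ (toℕ-combine b (opposite j)) (∑-oppositePairColumns q b j)) ⟩
  (k * toℕ b + toℕ j) + ((k * toℕ b + toℕ (opposite j)) + A)
    ≡⟨ regroup k (toℕ b) (toℕ j) (toℕ (opposite j)) A ⟩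
  toℕ b * (k + k) + ((toℕ j + toℕ (opposite j)) + A)
    ≡⟨ cong (λ s → toℕ b * (k + k) + (s + A)) (toℕ+toℕ-opposite j) ⟩
  toℕ b * (k + k) + (pred k + A) ∎
  where
  open ≡-Reasoning
  A : ℕ
  A = q * pred (2 * k)
  regroup : ∀ (k b j j′ A : ℕ) → (k * b + j) + ((k * b + j′) + A) ≡ b * (k + k) + ((j + j′) + A)
  regroup = solve-∀
∑-columns {k} (odd q) b j = begin
  toℕ (combine b j) + (toℕ (combine (opposite b) j)
    + (toℕ (cast (*-comm k 2) (combine (opposite j) b)) + ∑[ h < q * 2 ] toℕ (oppositePairColumns q h b j)))
    ≡⟨ cong₂ _+_ (toℕ-combine b j) (cong₂ _+_ (toℕ-combine (opposite b) j)
         (cong₂ _+_ (trans (toℕ-cast _ _) (toℕ-combine (opposite j) b)) (∑-oppositePairColumns q b j))) ⟩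
  (k * toℕ b + toℕ j) + ((k * toℕ (opposite b) + toℕ j) + ((2 * toℕ (opposite j) + toℕ b) + A))
    ≡⟨ regroup k (toℕ b) (toℕ (opposite b)) (toℕ j) (toℕ (opposite j)) A ⟩
  toℕ b + (k * (toℕ b + toℕ (opposite b)) + 2 * (toℕ j + toℕ (opposite j))) + A
    ≡⟨ cong₂ (λ s t → toℕ b + (k * s + 2 * t) + A) (toℕ+toℕ-opposite b) (toℕ+toℕ-opposite j) ⟩
  toℕ b + (k * 1 + 2 * pred k) + A
    ≡⟨ cong (λ s → toℕ b + (s + 2 * pred k) + A) (*-identityʳ k) ⟩
  toℕ b + (k + 2 * pred k) + A ∎
  where
  open ≡-Reasoning
  A : ℕ
  A = q * pred (2 * k)
  regroup : ∀ (k b b′ j j′ A : ℕ) →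
    (k * b + j) + ((k * b′ + j) + ((2 * j′ + b) + A)) ≡ b + (k * (b + b′) + 2 * (j + j′)) + A
  regroup = solve-∀

arrayRowSum-distinct : ∀ {k : ℕ} {n} (P : Parity n) → arrayRowSum (suc k) P 0F ≢ arrayRowSum (suc k) P 1F
arrayRowSum-distinct {k} (even q) = <⇒≢ (m<n+m _ {1 * (suc k + suc k)} z<s)
arrayRowSum-distinct     (odd q)  = <⇒≢ (n<1+n _)

rowSum : ∀ {m} n → Permutation′ (m * n) → Fin m → ℕ
rowSum n π g = ∑[ h < n ] label π (combine g h)

SideConstantRowSums : ∀ {m} n → (Fin m → Bool) → Permutation′ (m * n) → Set
SideConstantRowSums n side π =
  Σ (Bool → ℕ) λ c → c true ≢ c false × (∀ g → rowSum n π g ≡ c (side g))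

sideConstantLabelling : ∀ {m n k} (side : Fin m → Bool) →
  count side ≡ suc k → count (not ∘ side) ≡ suc k → Parity n →
  Σ (Permutation′ (m * n)) (SideConstantRowSums n side)
sideConstantLabelling {m} {n} {k} side trueCount falseCount P = π , c , c-distinct , rowSum≡
  where
  ρ : Fin m → Fin (suc k)
  ρ = proj₁ (colourClassIndexing side trueCount falseCount)

  ρ-injective : ∀ {g g′} → side g ≡ side g′ → ρ g ≡ ρ g′ → g ≡ g′
  ρ-injective = proj₂ (colourClassIndexing side trueCount falseCount)

  2k≡m : 2 * suc k ≡ m
  2k≡m = begin
    suc k + (suc k + 0)             ≡⟨ cong (suc k +_) (+-identityʳ (suc k)) ⟩
    suc k + suc k                   ≡⟨ cong₂ _+_ trueCount falseCount ⟨
    count side + count (not ∘ side) ≡⟨ count-complement side ⟩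
    m                               ∎
    where open ≡-Reasoning

  entry : Fin m → Fin n → Fin m
  entry g h = cast 2k≡m (columns P h (bit (side g)) (ρ g))

  cell : Fin m → Fin n → Fin (m * n)
  cell g h = combine (entry g h) h

  cell-injective : ∀ {g g′ h h′} → cell g h ≡ cell g′ h′ → g ≡ g′ × h ≡ h′
  cell-injective {g} {g′} {h} eq with combine-injective (entry g h) h _ _ eq
  ... | sameEntry , refl with columns-injective P h (cast-injective 2k≡m sameEntry)
  ... | sameBit , sameIndex = ρ-injective (bit-injective sameBit) sameIndex , refl

  relabel : Fin (m * n) → Fin (m * n)
  relabel x = uncurry cell (remQuot n x)

  relabel-injective : Injective _≡_ _≡_ relabel
  relabel-injective {x} {y} eq = begin
    x                                 ≡⟨ combine-remQuot {m} n x ⟨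
    uncurry combine (remQuot {m} n x) ≡⟨ cong₂ combine (proj₁ sameCell) (proj₂ sameCell) ⟩
    uncurry combine (remQuot {m} n y) ≡⟨ combine-remQuot {m} n y ⟩
    y                                 ∎
    where
    open ≡-Reasoning
    sameCell : quotient n x ≡ quotient n y × proj₂ (remQuot {m} n x) ≡ proj₂ (remQuot {m} n y)
    sameCell = cell-injective eq

  π : Permutation′ (m * n)
  π = injective⇒permutation relabel relabel-injective

  c : Bool → ℕ
  c s = n * arrayRowSum (suc k) P (bit s) + ∑[ h < n ] suc (toℕ h)

  c-distinct : c true ≢ c false
  c-distinct eq =
    arrayRowSum-distinct P (sym (*-cancelˡ-≡ _ _ n {{Parity⇒NonZero P}} (+-cancelʳ-≡ _ _ _ eq)))

  toℕ-cell : ∀ g h → suc (toℕ (cell g h)) ≡ n * toℕ (columns P h (bit (side g)) (ρ g)) + suc (toℕ h)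
  toℕ-cell g h = begin
    suc (toℕ (combine (entry g h) h))  ≡⟨ cong suc (toℕ-combine (entry g h) h) ⟩
    suc (n * toℕ (entry g h) + toℕ h)  ≡⟨ +-suc _ _ ⟨
    n * toℕ (entry g h) + suc (toℕ h)  ≡⟨ cong (λ e → n * e + suc (toℕ h)) (toℕ-cast 2k≡m _) ⟩
    n * toℕ (columns P h (bit (side g)) (ρ g)) + suc (toℕ h) ∎
    where open ≡-Reasoning

  rowSum≡ : ∀ g → rowSum n π g ≡ c (side g)
  rowSum≡ g = begin
    ∑[ h < n ] suc (toℕ (relabel (combine g h)))
      ≡⟨ sum-cong-≗ (λ h → cong (suc ∘ toℕ ∘ uncurry cell) (remQuot-combine g h)) ⟩
    ∑[ h < n ] suc (toℕ (cell g h))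
      ≡⟨ sum-cong-≗ (toℕ-cell g) ⟩
    ∑[ h < n ] (n * toℕ (columns P h b j) + suc (toℕ h))
      ≡⟨ ∑-distrib-+ (λ h → n * toℕ (columns P h b j)) (λ h → suc (toℕ h)) ⟩
    ∑[ h < n ] (n * toℕ (columns P h b j)) + ∑[ h < n ] suc (toℕ h)
      ≡⟨ cong (_+ ∑[ h < n ] suc (toℕ h)) (*-distribˡ-sum n (λ h → toℕ (columns P h b j))) ⟨
    n * ∑[ h < n ] toℕ (columns P h b j) + ∑[ h < n ] suc (toℕ h)
      ≡⟨ cong (λ s → n * s + ∑[ h < n ] suc (toℕ h)) (∑-columns P b j) ⟩
    c (side g) ∎
    where
    open ≡-Reasoning
    b : Fin 2
    b = bit (side g)
    j : Fin (suc k)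
    j = ρ g

IsProperColouring : ∀ {m} → Graph m → (Fin m → Bool) → Set
IsProperColouring G side = ∀ u v → adj G u v ≡ true → side u ≢ side v

adj-lexProduct-emptyGraph : ∀ {m n} (G : Graph m) x y →
  adj (lexProduct G (emptyGraph n)) x y ≡ adj G (quotient n x) (quotient n y)
adj-lexProduct-emptyGraph G x y = trans (cong (adj G _ _ ∨_) (∧-zeroʳ _)) (∨-identityʳ _)

adj-lexProduct-combine : ∀ {m n} (G : Graph m) g g′ (h h′ : Fin n) →
  adj (lexProduct G (emptyGraph n)) (combine g h) (combine g′ h′) ≡ adj G g g′
adj-lexProduct-combine G g g′ h h′ =
  trans (adj-lexProduct-emptyGraph G (combine g h) (combine g′ h′))
        (cong₂ (adj G) (cong proj₁ (remQuot-combine g h)) (cong proj₁ (remQuot-combine g′ h′)))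

weight-lexProduct-emptyGraph : ∀ {m n} (G : Graph m) π u →
  weight (lexProduct G (emptyGraph n)) π u ≡ ∑[ g < m ] (indicator (adj G (quotient n u) g) * rowSum n π g)
weight-lexProduct-emptyGraph {m} {n} G π u = begin
  weight L π u
    ≡⟨ listSum-map-tabulate summand id ⟩
  ∑[ x < m * n ] summand x
    ≡⟨ ∑-combine m n summand ⟩
  ∑[ g < m ] ∑[ h < n ] summand (combine g h)
    ≡⟨ sum-cong-≗ (λ g → sum-cong-≗ (summand-combine g)) ⟩
  ∑[ g < m ] ∑[ h < n ] (indicator (adj G u₀ g) * label π (combine g h))
    ≡⟨ sum-cong-≗ (λ g → *-distribˡ-sum (indicator (adj G u₀ g)) (label π ∘ combine g)) ⟨
  ∑[ g < m ] (indicator (adj G u₀ g) * rowSum n π g) ∎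
  where
  open ≡-Reasoning
  L : Graph (m * n)
  L = lexProduct G (emptyGraph n)

  u₀ : Fin m
  u₀ = quotient n u

  summand : Fin (m * n) → ℕ
  summand x = if adj L u x then label π x else 0

  summand-combine : ∀ g h → summand (combine g h) ≡ indicator (adj G u₀ g) * label π (combine g h)
  summand-combine g h = begin
    (if adj L u (combine g h) then label π (combine g h) else 0)
      ≡⟨ cong (λ a → if a then label π (combine g h) else 0) (adj-lexProduct-emptyGraph G u (combine g h)) ⟩
    (if adj G u₀ (quotient n (combine g h)) then label π (combine g h) else 0)
      ≡⟨ cong (λ v → if adj G u₀ v then label π (combine g h) else 0) (cong proj₁ (remQuot-combine g h)) ⟩
    (if adj G u₀ g then label π (combine g h) else 0)
      ≡⟨ if≡indicator* (adj G u₀ g) _ ⟩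
    indicator (adj G u₀ g) * label π (combine g h) ∎

weight-sideConstantRowSums : ∀ {m n r} (G : Graph m) (side : Fin m → Bool) π (c : Bool → ℕ) →
  Regular r G → IsProperColouring G side → (∀ g → rowSum n π g ≡ c (side g)) →
  ∀ u → weight (lexProduct G (emptyGraph n)) π u ≡ r * c (not (side (quotient n u)))
weight-sideConstantRowSums {m} {n} {r} G side π c regular proper rowSum≡ u = begin
  weight (lexProduct G (emptyGraph n)) π u
    ≡⟨ weight-lexProduct-emptyGraph G π u ⟩
  ∑[ g < m ] (indicator (adj G u₀ g) * rowSum n π g)
    ≡⟨ sum-cong-≗ neighbourTerm ⟩
  ∑[ g < m ] (indicator (adj G u₀ g) * c (not (side u₀)))
    ≡⟨ *-distribʳ-sum (c (not (side u₀))) (indicator ∘ adj G u₀) ⟨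
  count (adj G u₀) * c (not (side u₀))
    ≡⟨ cong (_* c (not (side u₀))) (trans (sym (countT≡count (adj G u₀))) (regular u₀)) ⟩
  r * c (not (side u₀)) ∎
  where
  open ≡-Reasoning
  u₀ : Fin m
  u₀ = quotient n u

  neighbourTerm : ∀ g →
    indicator (adj G u₀ g) * rowSum n π g ≡ indicator (adj G u₀ g) * c (not (side u₀))
  neighbourTerm g with adj G u₀ g in u₀g
  ... | false = refl
  ... | true  = cong (1 *_) (trans (rowSum≡ g) (cong c (¬-not (proper u₀ g u₀g ∘ sym))))

distinct-∈⇒2≤length : ∀ {A : Set} {a b : A} (xs : List A) → a ∈ xs → b ∈ xs → a ≢ b → 2 ≤ length xs
distinct-∈⇒2≤length (_ ∷ [])    (here refl) (here refl) a≢b = contradiction refl a≢b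
distinct-∈⇒2≤length (_ ∷ _ ∷ _) _           _           _   = s≤s (s≤s z≤n)

unique-⊆pair⇒length≤2 : ∀ {A : Set} {a b : A} (xs : List A) → Unique xs →
  (∀ {x} → x ∈ xs → x ≡ a ⊎ x ≡ b) → length xs ≤ 2
unique-⊆pair⇒length≤2 []           _ _ = z≤n
unique-⊆pair⇒length≤2 (_ ∷ [])     _ _ = s≤s z≤n
unique-⊆pair⇒length≤2 (_ ∷ _ ∷ []) _ _ = s≤s (s≤s z≤n)
unique-⊆pair⇒length≤2 (x ∷ y ∷ z ∷ _) ((x≢y ∷ x≢z ∷ _) ∷ (y≢z ∷ _) ∷ _) inPair
  with inPair (here refl) | inPair (there (here refl)) | inPair (there (there (here refl)))
... | inj₁ refl | inj₁ refl | _         = contradiction refl x≢y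
... | inj₂ refl | inj₂ refl | _         = contradiction refl x≢y
... | inj₁ refl | inj₂ refl | inj₁ refl = contradiction refl x≢z
... | inj₁ refl | inj₂ refl | inj₂ refl = contradiction refl y≢z
... | inj₂ refl | inj₁ refl | inj₁ refl = contradiction refl y≢z
... | inj₂ refl | inj₁ refl | inj₂ refl = contradiction refl x≢z

numWeights≥2 : ∀ {N} (G : Graph N) π → IsLocalDistanceAntimagic G π →
  ∀ {u v} → adj G u v ≡ true → 2 ≤ numWeights G π
numWeights≥2 {N} G π antimagic {u} {v} uv =
  distinct-∈⇒2≤length (deduplicate _≟_ weights) (listed u) (listed v) (antimagic u v uv)
  where
  weights : List ℕ
  weights = map (weight G π) (allFin N)

  listed : ∀ x → weight G π x ∈ deduplicate _≟_ weights
  listed x = ∈-deduplicate⁺ _≟_ (∈-map⁺ (weight G π) (∈-allFin x))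

numWeights≤2 : ∀ {N} (G : Graph N) π {a b} → (∀ u → weight G π u ≡ a ⊎ weight G π u ≡ b) →
  numWeights G π ≤ 2
numWeights≤2 {N} G π {a} {b} twoValues =
  unique-⊆pair⇒length≤2 (deduplicate _≟_ weights) (deduplicate-! _≟_ weights) inPair
  where
  weights : List ℕ
  weights = map (weight G π) (allFin N)

  inPair : ∀ {x} → x ∈ deduplicate _≟_ weights → x ≡ a ⊎ x ≡ b
  inPair x∈ with ∈-map⁻ (weight G π) (∈-deduplicate⁻ _≟_ weights x∈)
  ... | u , _ , refl = twoValues u

lexProduct-chiLd≡2 : ∀ {m n r} (G : Graph m) (side : Fin m → Bool) → 0 < m → 0 < n →
  Regular (suc r) G → IsProperColouring G side →
  (π : Permutation′ (m * n)) → SideConstantRowSums n side π →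
  ChiLd≡ (lexProduct G (emptyGraph n)) 2
lexProduct-chiLd≡2 {m} {n} {r} G side m>0 n>0 regular proper π (c , c-distinct , rowSum≡) =
  (π , antimagic , ≤-antisym (numWeights≤2 L π twoValues) (numWeights≥2 L π antimagic edge)) ,
  λ π′ antimagic′ → numWeights≥2 L π′ antimagic′ edge
  where
  L : Graph (m * n)
  L = lexProduct G (emptyGraph n)

  weight≡ : ∀ u → weight L π u ≡ suc r * c (not (side (quotient n u)))
  weight≡ = weight-sideConstantRowSums G side π c regular proper rowSum≡

  c-injective : ∀ {s t} → c s ≡ c t → s ≡ t
  c-injective {true}  {true}  _  = refl
  c-injective {true}  {false} eq = contradiction eq c-distinct
  c-injective {false} {true}  eq = contradiction (sym eq) c-distinct
  c-injective {false} {false} _  = refl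

  antimagic : IsLocalDistanceAntimagic L π
  antimagic u v uv sameWeight =
    proper (quotient n u) (quotient n v) (trans (sym (adj-lexProduct-emptyGraph G u v)) uv)
      (not-injective (c-injective (*-cancelˡ-≡ _ _ (suc r)
        (trans (sym (weight≡ u)) (trans sameWeight (weight≡ v))))))

  twoValues : ∀ u → weight L π u ≡ suc r * c true ⊎ weight L π u ≡ suc r * c false
  twoValues u with not (side (quotient n u)) in notSide
  ... | true  = inj₁ (trans (weight≡ u) (cong (λ s → suc r * c s) notSide))
  ... | false = inj₂ (trans (weight≡ u) (cong (λ s → suc r * c s) notSide))

  g₀ : Fin m
  g₀ = fromℕ< m>0

  neighbour : ∃ λ g₁ → adj G g₀ g₁ ≡ true
  neighbour = count>0⇒∃ (adj G g₀)
    (subst (0 <_) (trans (sym (regular g₀)) (countT≡count (adj G g₀))) z<s)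

  h₀ : Fin n
  h₀ = fromℕ< n>0

  edge : adj L (combine g₀ h₀) (combine (proj₁ neighbour) h₀) ≡ true
  edge = trans (adj-lexProduct-combine G g₀ (proj₁ neighbour) h₀ h₀) (proj₂ neighbour)

mainTheorem6 : (n m r : ℕ) → 1 < n → 1 < m → 1 ≤ r →
    (G : Graph m) → Regular r G → BalancedBipartite G →
    ChiLd≡ (lexProduct G (emptyGraph n)) 2
mainTheorem6 n m (suc r) 1<n 1<m (s≤s z≤n) G regular (side , proper , balanced) =
  let k , trueCount , falseCount = balanced⇒halves side balanced′ (m<n⇒0<n 1<m)
      π , sideConstant = sideConstantLabelling side trueCount falseCount (parity 1<n)
  in  lexProduct-chiLd≡2 G side (m<n⇒0<n 1<m) (m<n⇒0<n 1<n) regular proper π sideConstant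
  where
  balanced′ : count side ≡ count (not ∘ side)
  balanced′ = trans (sym (countT≡count side)) (trans balanced (countT≡count (not ∘ side)))
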